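{- Let $D$ be a strongly connected directed graph (multiple edges allowed) with a fixed cyclic ordering of the out-edges at each vertex. Then all orbits of the rotor-router operation on the set of unicycles of $D$ have the same size.
   Context: At each vertex $v$ a cyclic ordering of the outgoing edges is fixed; for an edge $e$ with tail $v$, $e^+$ denotes the next edge in this cyclic order. A rotor configuration $\varrho$ assigns to each vertex $v$ an out-edge $\varrho(v)$ with tail $v$. A chip-and-rotor configuration is a pair $(w,\varrho)$ with $w$ a vertex and $\varrho$ a rotor configuration. The rotor-router operation sends $(w,\varrho)$ to $(w^+,\varrho^+)$, where $\varrho^+(v)=\varrho(v)$ for $v\neq w$, $\varrho^+(w)=\varrho(w)^+$, and $w^+$ is the head of $\varrho^+(w)$. A unicycle is a chip-and-rotor configuration $(w,\varrho)$ such that $\{\varrho(v):v\in V\}$ contains a unique directed cycle and $w$ lies on it. For strongly connected $D$, the rotor-router operation is a permutation of the set of unicycles; a unicycle-orbit is an orbit of this permutation. -}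

module Defs where

open import Data.Nat using (ℕ; zero; suc; _≤_; _<_)
open import Data.Fin using (Fin; _≟_)
open import Data.Product using (Σ; ∃; _×_; _,_)
open import Relation.Nullary using (¬_; yes; no)
open import Relation.Binary.PropositionalEquality using (_≡_)

iter : ∀ {A : Set} → (A → A) → ℕ → A → A
iter f zero    x = x
iter f (suc k) x = f (iter f k x)

-- A directed multigraph (loops and multiple edges allowed) with vertex set
-- Fin n and edge set Fin m, given by tail and head maps, together with a
-- "next edge" map encoding the cyclic order of out-edges at each vertex.
record RotorGraph : Set where
  field
    n    : ℕ
    m    : ℕ
    tail : Fin m → Fin n
    head : Fin m → Fin n
    next : Fin m → Fin m

  Vertex = Fin n
  Edge   = Fin m

  data Path : Vertex → Vertex → Set where
    here  : ∀ {v} → Path v v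
    there : ∀ {v w} (e : Edge) → tail e ≡ v → Path (head e) w → Path v w

  StronglyConnected : Set
  StronglyConnected = ∀ u v → Path u v

  -- next is a cyclic ordering of the out-edges at each vertex:
  -- it preserves tails and is transitive on the out-edges of each vertex
  -- (on a finite set this makes it a single cyclic permutation of out(v)).
  CyclicOrdering : Set
  CyclicOrdering =
    (∀ e → tail (next e) ≡ tail e) ×
    (∀ e e' → tail e ≡ tail e' → ∃ λ k → iter next k e ≡ e')

  RotorConfig : (Vertex → Edge) → Set
  RotorConfig ρ = ∀ v → tail (ρ v) ≡ v

  -- Chip-and-rotor configurations (the rotor property is a separate predicate)
  State : Set
  State = Vertex × (Vertex → Edge)

  _≈_ : State → State → Set
  (w , ρ) ≈ (w' , ρ') = (w ≡ w') × (∀ v → ρ v ≡ ρ' v)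

  update : (Vertex → Edge) → Vertex → Vertex → Edge
  update ρ w v with v ≟ w
  ... | yes _ = next (ρ w)
  ... | no  _ = ρ v

  step : State → State
  step (w , ρ) = head (next (ρ w)) , update ρ w

  succ : (Vertex → Edge) → Vertex → Vertex
  succ ρ v = head (ρ v)

  OnCycle : (Vertex → Edge) → Vertex → Set
  OnCycle ρ v = ∃ λ k → (1 ≤ k) × (iter (succ ρ) k v ≡ v)

  -- Unicycle: the rotor subgraph contains a unique directed cycle and w lies
  -- on it; i.e. w is on a cycle and every vertex on any cycle lies on the
  -- cycle through w.
  Unicycle : State → Set
  Unicycle (w , ρ) =
    RotorConfig ρ ×
    OnCycle ρ w ×
    (∀ u → OnCycle ρ u → ∃ λ i → iter (succ ρ) i w ≡ u)

  IsOrbitSize : State → ℕ → Set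
  IsOrbitSize x N =
    (1 ≤ N) × (iter step N x ≈ x) ×
    (∀ k → 1 ≤ k → k < N → ¬ (iter step k x ≈ x))

-- Call L a return time if some chip-and-rotor configuration (rotors at their vertices) is back
-- to itself after L rotor-router steps.  Every unicycle is then back after L steps as well, so
-- all unicycles share the same return times and hence the same orbit size, the least positive one.
--
-- If a configuration returns after L steps, its firing counts F make every rotor turn full
-- circles and are balanced: each vertex receives exactly as many chips as it fires.  Neither
-- property depends on the starting positions of the rotors.  Run a unicycle (w , ρ) until some
-- vertex v has fired F v times.  The walk has crossed no edge more often than F prescribes, so
-- v ≠ w is impossible: v would have received F v + 1 chips.  Exhaustion then propagates backwards
-- along the rotors: if head (ρ u) is exhausted, all its in-edges are saturated, among them ρ u,
-- the last edge served from u.  In a unicycle every vertex reaches w along the rotors, so every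
-- vertex is exhausted and the walk is back at (w , ρ) after ∑ F = L steps.

module Submission where

open import Defs
open import Data.Nat using (ℕ; zero; suc; _+_; _*_; _∸_; _≤_; _<_; z≤n; s≤s; _^_)
import Data.Nat as ℕ
open import Data.Nat.Properties hiding (_≟_)
open import Data.Fin using (Fin; zero; suc; _≟_; toℕ; combine; remQuot; funToFin; finToFun)
import Data.Fin.Properties as Fin
open import Data.Product using (∃; _×_; _,_; proj₁; proj₂)
open import Data.Sum using (_⊎_; inj₁; inj₂)
open import Data.Empty using (⊥-elim)
open import Function using (_∘_; case_of_)
open import Relation.Nullary using (¬_; Dec; yes; no)
open import Relation.Nullary.Decidable using (_×-dec_)
open import Relation.Unary using (Decidable)
open import Relation.Binary.Definitions using (DecidableEquality)
open import Relation.Binary.PropositionalEquality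
open import Algebra.Properties.CommutativeMonoid.Sum +-0-commutativeMonoid
  using (sum-syntax; sum-cong-≗; ∑-distrib-+; sum-replicate-zero)

𝟙 : ∀ {A : Set} → Dec A → ℕ
𝟙 (yes _) = 1
𝟙 (no _)  = 0

𝟙-yes : ∀ {A : Set} (d : Dec A) → A → 𝟙 d ≡ 1
𝟙-yes (yes _) _ = refl
𝟙-yes (no ¬a) a = ⊥-elim (¬a a)

𝟙-no : ∀ {A : Set} (d : Dec A) → ¬ A → 𝟙 d ≡ 0
𝟙-no (yes a) ¬a = ⊥-elim (¬a a)
𝟙-no (no _)  _  = refl

𝟙-suc : ∀ {k} (i j : Fin k) → 𝟙 (suc i ≟ suc j) ≡ 𝟙 (i ≟ j)
𝟙-suc i j with i ≟ j
... | yes _ = refl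
... | no _  = refl

∑-zero : ∀ k {f : Fin k → ℕ} → (∀ i → f i ≡ 0) → ∑[ i < k ] f i ≡ 0
∑-zero k f≡0 = trans (sum-cong-≗ f≡0) (sum-replicate-zero k)

∑-𝟙-* : ∀ {k} (f : Fin k → ℕ) (c : Fin k) → ∑[ i < k ] (𝟙 (i ≟ c) * f i) ≡ f c
∑-𝟙-* {suc k} f zero = begin
  1 * f zero + ∑[ i < k ] (𝟙 (suc i ≟ zero) * f (suc i))
    ≡⟨ cong (1 * f zero +_) (∑-zero k (λ _ → refl)) ⟩
  1 * f zero + 0
    ≡⟨ trans (+-identityʳ _) (*-identityˡ _) ⟩
  f zero ∎
  where open ≡-Reasoning
∑-𝟙-* {suc k} f (suc c) =
  trans (sum-cong-≗ (λ i → cong (_* f (suc i)) (𝟙-suc i c))) (∑-𝟙-* (f ∘ suc) c)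

∑-𝟙 : ∀ {k} (c : Fin k) → ∑[ i < k ] 𝟙 (i ≟ c) ≡ 1
∑-𝟙 c = trans (sum-cong-≗ (λ i → sym (*-identityʳ (𝟙 (i ≟ c))))) (∑-𝟙-* (λ _ → 1) c)

∑-mono : ∀ {k} {f g : Fin k → ℕ} → (∀ i → f i ≤ g i) → ∑[ i < k ] f i ≤ ∑[ i < k ] g i
∑-mono {zero}  _   = z≤n
∑-mono {suc k} f≤g = +-mono-≤ (f≤g zero) (∑-mono (f≤g ∘ suc))

∑-mono-≡⇒≡ : ∀ {k} {f g : Fin k → ℕ} → (∀ i → f i ≤ g i) →
             ∑[ i < k ] f i ≡ ∑[ i < k ] g i → ∀ i → f i ≡ g i
∑-mono-≡⇒≡ {suc k} {f} {g} f≤g eq = λ where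
    zero    → head≡
    (suc i) → ∑-mono-≡⇒≡ (f≤g ∘ suc) (+-cancelˡ-≡ (f zero) _ _ (trans eq (cong (_+ _) (sym head≡)))) i
  where
  head≡ : f zero ≡ g zero
  head≡ = ≤-antisym (f≤g zero) (+-cancelʳ-≤ _ _ _ (begin
    g zero + ∑[ i < k ] f (suc i) ≤⟨ +-monoʳ-≤ (g zero) (∑-mono (f≤g ∘ suc)) ⟩
    g zero + ∑[ i < k ] g (suc i) ≡⟨ sym eq ⟩
    f zero + ∑[ i < k ] f (suc i) ∎))
    where open ≤-Reasoning

least-below : ∀ {P : ℕ → Set} → Decidable P → ∀ k →
              (∃ λ L → L < k × P L × ∀ j → j < L → ¬ P j) ⊎ (∀ j → j < k → ¬ P j)
least-below P? zero = inj₂ (λ _ ())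
least-below P? (suc k) with least-below P? k
... | inj₁ (L , L<k , pL , below-L) = inj₁ (L , m<n⇒m<1+n L<k , pL , below-L)
... | inj₂ none-below-k with P? k
...   | yes pk  = inj₁ (k , n<1+n k , pk , none-below-k)
...   | no  ¬pk = inj₂ λ j j<1+k → case m<1+n⇒m<n∨m≡n j<1+k of λ where
          (inj₁ j<k)  → none-below-k j j<k
          (inj₂ refl) → ¬pk

iter-+ : ∀ {A : Set} (f : A → A) i j x → iter f (i + j) x ≡ iter f i (iter f j x)
iter-+ f zero    j x = refl
iter-+ f (suc i) j x = cong f (iter-+ f i j x)

iter-comm : ∀ {A : Set} (f : A → A) i j x → iter f i (iter f j x) ≡ iter f j (iter f i x)
iter-comm f i j x = begin
  iter f i (iter f j x) ≡⟨ iter-+ f i j x ⟨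
  iter f (i + j) x      ≡⟨ cong (λ k → iter f k x) (+-comm i j) ⟩
  iter f (j + i) x      ≡⟨ iter-+ f j i x ⟩
  iter f j (iter f i x) ∎
  where open ≡-Reasoning

iter-* : ∀ {A : Set} (f : A → A) {p x} → iter f p x ≡ x → ∀ k → iter f (k * p) x ≡ x
iter-* f         fᵖx≡x zero    = refl
iter-* f {p} {x} fᵖx≡x (suc k) = begin
  iter f (p + k * p) x        ≡⟨ iter-+ f p (k * p) x ⟩
  iter f p (iter f (k * p) x) ≡⟨ cong (iter f p) (iter-* f fᵖx≡x k) ⟩
  iter f p x                  ≡⟨ fᵖx≡x ⟩
  x                           ∎
  where open ≡-Reasoning

iter-reflect : ∀ {A : Set} (f : A → A) (P : A → Set) → (∀ x → P (f x) → P x) →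
               ∀ j x → P (iter f j x) → P x
iter-reflect f P reflect zero    x p = p
iter-reflect f P reflect (suc j) x p = iter-reflect f P reflect j x (reflect (iter f j x) p)

periodic-return : ∀ {A : Set} (f : A → A) {p x} → 1 ≤ p → iter f p x ≡ x →
                  ∀ k → iter f (k * p ∸ k) (iter f k x) ≡ x
periodic-return f {suc p} {x} _ fᵖx≡x k = begin
  iter f (k * suc p ∸ k) (iter f k x) ≡⟨ iter-+ f (k * suc p ∸ k) k x ⟨
  iter f (k * suc p ∸ k + k) x        ≡⟨ cong (λ i → iter f i x) (m∸n+n≡m (m≤m*n k (suc p))) ⟩
  iter f (k * suc p) x                ≡⟨ iter-* f fᵖx≡x k ⟩
  x                                   ∎
  where open ≡-Reasoning

reaches-cycle : ∀ {k} (f : Fin k → Fin k) u →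
                ∃ λ i → ∃ λ d → 1 ≤ d × iter f d (iter f i u) ≡ iter f i u
reaches-cycle {k} f u with Fin.pigeonhole (n<1+n k) (λ i → iter f (toℕ i) u)
... | i , j , i<j , fⁱu≡fʲu = toℕ i , toℕ j ∸ toℕ i , m<n⇒0<n∸m i<j , (begin
  iter f (toℕ j ∸ toℕ i) (iter f (toℕ i) u) ≡⟨ iter-+ f (toℕ j ∸ toℕ i) (toℕ i) u ⟨
  iter f (toℕ j ∸ toℕ i + toℕ i) u          ≡⟨ cong (λ t → iter f t u) (m∸n+n≡m (<⇒≤ i<j)) ⟩
  iter f (toℕ j) u                          ≡⟨ fⁱu≡fʲu ⟨
  iter f (toℕ i) u                          ∎)
  where open ≡-Reasoning

module Visits {A : Set} (_≟ᴬ_ : DecidableEquality A) (f : A → A) where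

  visits : A → ℕ → A → ℕ
  visits a zero    b = 0
  visits a (suc k) b = 𝟙 (b ≟ᴬ iter f (suc k) a) + visits a k b

  visits-mono : ∀ {a b k K} → k ≤ K → visits a k b ≤ visits a K b
  visits-mono {K = zero} z≤n = ≤-refl
  visits-mono {K = suc K} k≤1+K with m≤n⇒m<n∨m≡n k≤1+K
  ... | inj₂ refl      = ≤-refl
  ... | inj₁ (s≤s k≤K) = ≤-trans (visits-mono k≤K) (m≤n+m _ _)

  visits-strict : ∀ {a k K} → iter f K a ≡ a → k < K → visits a k a < visits a K a
  visits-strict {a} {k} {suc K} fᴷa≡a (s≤s k≤K) = begin-strict
    visits a k a                                    ≤⟨ visits-mono k≤K ⟩
    visits a K a                                    <⟨ n<1+n _ ⟩
    1 + visits a K a                                ≡⟨ cong (_+ visits a K a) (𝟙-yes (a ≟ᴬ _) (sym fᴷa≡a)) ⟨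
    𝟙 (a ≟ᴬ iter f (suc K) a) + visits a K a        ∎
    where open ≤-Reasoning

  visits-from-f : ∀ a k b → visits (f a) k b + 𝟙 (b ≟ᴬ f a) ≡ visits a (suc k) b
  visits-from-f a zero    b = +-comm 0 (𝟙 (b ≟ᴬ f a))
  visits-from-f a (suc k) b = begin
    (𝟙 (b ≟ᴬ iter f (suc k) (f a)) + visits (f a) k b) + 𝟙 (b ≟ᴬ f a)
      ≡⟨ +-assoc (𝟙 (b ≟ᴬ iter f (suc k) (f a))) (visits (f a) k b) (𝟙 (b ≟ᴬ f a)) ⟩
    𝟙 (b ≟ᴬ iter f (suc k) (f a)) + (visits (f a) k b + 𝟙 (b ≟ᴬ f a))
      ≡⟨ cong₂ _+_ (cong (λ c → 𝟙 (b ≟ᴬ f c)) (iter-comm f k 1 a)) (visits-from-f a k b) ⟩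
    visits a (suc (suc k)) b ∎
    where open ≡-Reasoning

  visits-rotate : ∀ {a K} → iter f K a ≡ a → ∀ j b → visits (iter f j a) K b ≡ visits a K b
  visits-rotate                fᴷa≡a zero    b = refl
  visits-rotate {a} {K} fᴷa≡a (suc j) b = trans (+-cancelʳ-≡ _ _ _ (begin
    visits (f c) K b + 𝟙 (b ≟ᴬ f c)        ≡⟨ visits-from-f c K b ⟩
    𝟙 (b ≟ᴬ f (iter f K c)) + visits c K b ≡⟨ cong (λ d → 𝟙 (b ≟ᴬ f d) + visits c K b) fᴷc≡c ⟩
    𝟙 (b ≟ᴬ f c) + visits c K b            ≡⟨ +-comm _ (visits c K b) ⟩
    visits c K b + 𝟙 (b ≟ᴬ f c)            ∎)) (visits-rotate {K = K} fᴷa≡a j b)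
    where
    open ≡-Reasoning
    c = iter f j a
    fᴷc≡c : iter f K c ≡ c
    fᴷc≡c = trans (iter-comm f K j a) (cong (iter f j) fᴷa≡a)

module Rotors (D : RotorGraph) where
  open RotorGraph D
  open Visits _≟_ next

  tail-iter : (∀ e → tail (next e) ≡ tail e) → ∀ k e → tail (iter next k e) ≡ tail e
  tail-iter tail-next zero    e = refl
  tail-iter tail-next (suc k) e = trans (tail-next (iter next k e)) (tail-iter tail-next k e)

  module Walk (s : State) where

    walk : ℕ → State
    walk t = iter step t s

    chip : ℕ → Vertex
    chip t = proj₁ (walk t)

    rotor : ℕ → Vertex → Edge
    rotor t = proj₂ (walk t)

    out : ℕ → Edge
    out t = next (rotor t (chip t))

    fired : ℕ → Vertex → ℕ
    fired zero    u = 0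
    fired (suc t) u = 𝟙 (u ≟ chip t) + fired t u

    arrived : ℕ → Vertex → ℕ
    arrived zero    v = 0
    arrived (suc t) v = 𝟙 (v ≟ head (out t)) + arrived t v

    crossed : ℕ → Edge → ℕ
    crossed zero    e = 0
    crossed (suc t) e = 𝟙 (e ≟ out t) + crossed t e

    rotor-fired : ∀ t u → rotor t u ≡ iter next (fired t u) (proj₂ s u)
    rotor-fired zero    u = refl
    rotor-fired (suc t) u with u ≟ chip t
    ... | yes refl = cong next (rotor-fired t u)
    ... | no  _    = rotor-fired t u

    arrived-fired : ∀ t v → arrived t v + 𝟙 (v ≟ chip 0) ≡ fired t v + 𝟙 (v ≟ chip t)
    arrived-fired zero    v = refl
    arrived-fired (suc t) v = begin
      (a + arrived t v) + 𝟙 (v ≟ chip 0)   ≡⟨ +-assoc a (arrived t v) _ ⟩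
      a + (arrived t v + 𝟙 (v ≟ chip 0))   ≡⟨ cong (a +_) (arrived-fired t v) ⟩
      a + (fired t v + 𝟙 (v ≟ chip t))     ≡⟨ +-comm a _ ⟩
      (fired t v + 𝟙 (v ≟ chip t)) + a     ≡⟨ cong (_+ a) (+-comm (fired t v) _) ⟩
      fired (suc t) v + a                  ∎
      where
      open ≡-Reasoning
      a = 𝟙 (v ≟ head (out t))

    ∑-fired : ∀ t → ∑[ u < n ] fired t u ≡ t
    ∑-fired zero    = ∑-zero n (λ _ → refl)
    ∑-fired (suc t) = begin
      ∑[ u < n ] (𝟙 (u ≟ chip t) + fired t u)            ≡⟨ ∑-distrib-+ _ (fired t) ⟩
      ∑[ u < n ] 𝟙 (u ≟ chip t) + ∑[ u < n ] fired t u ≡⟨ cong₂ _+_ (∑-𝟙 (chip t)) (∑-fired t) ⟩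
      suc t                                              ∎
      where open ≡-Reasoning

    arrived-crossed : ∀ t v → arrived t v ≡ ∑[ e < m ] (𝟙 (v ≟ head e) * crossed t e)
    arrived-crossed zero    v = sym (∑-zero m (λ e → *-zeroʳ (𝟙 (v ≟ head e))))
    arrived-crossed (suc t) v = begin
      𝟙 (v ≟ head (out t)) + arrived t v
        ≡⟨ cong₂ _+_ (∑-𝟙-* (λ e → 𝟙 (v ≟ head e)) (out t)) (sym (arrived-crossed t v)) ⟨
      ∑[ e < m ] (𝟙 (e ≟ out t) * 𝟙 (v ≟ head e)) + ∑[ e < m ] (𝟙 (v ≟ head e) * crossed t e)
        ≡⟨ ∑-distrib-+ (λ e → 𝟙 (e ≟ out t) * 𝟙 (v ≟ head e)) _ ⟨
      ∑[ e < m ] (𝟙 (e ≟ out t) * 𝟙 (v ≟ head e) + 𝟙 (v ≟ head e) * crossed t e)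
        ≡⟨ sum-cong-≗ (λ e → cong (_+ 𝟙 (v ≟ head e) * crossed t e) (*-comm (𝟙 (e ≟ out t)) _)) ⟩
      ∑[ e < m ] (𝟙 (v ≟ head e) * 𝟙 (e ≟ out t) + 𝟙 (v ≟ head e) * crossed t e)
        ≡⟨ sum-cong-≗ (λ e → *-distribˡ-+ (𝟙 (v ≟ head e)) (𝟙 (e ≟ out t)) _) ⟨
      ∑[ e < m ] (𝟙 (v ≟ head e) * crossed (suc t) e) ∎
      where open ≡-Reasoning

    module _ (tail-next : ∀ e → tail (next e) ≡ tail e) (rc : RotorConfig (proj₂ s)) where

      tail-out : ∀ t → tail (out t) ≡ chip t
      tail-out t = begin
        tail (next (rotor t (chip t)))                           ≡⟨ tail-next _ ⟩
        tail (rotor t (chip t))                                  ≡⟨ cong tail (rotor-fired t (chip t)) ⟩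
        tail (iter next (fired t (chip t)) (proj₂ s (chip t)))   ≡⟨ tail-iter tail-next (fired t (chip t)) _ ⟩
        tail (proj₂ s (chip t))                                  ≡⟨ rc (chip t) ⟩
        chip t                                                   ∎
        where open ≡-Reasoning

      crossed-visits : ∀ t e → crossed t e ≡ visits (proj₂ s (tail e)) (fired t (tail e)) e
      crossed-visits zero    e = refl
      crossed-visits (suc t) e with tail e ≟ chip t
      ... | yes tail-e≡chip = cong₂ _+_ (cong (λ u → 𝟙 (e ≟ next u)) out-rotor) (crossed-visits t e)
        where
        out-rotor : rotor t (chip t) ≡ iter next (fired t (tail e)) (proj₂ s (tail e))
        out-rotor = trans (cong (rotor t) (sym tail-e≡chip)) (rotor-fired t (tail e))
      ... | no tail-e≢chip = trans (cong (_+ crossed t e) (𝟙-no (e ≟ out t) e≢out)) (crossed-visits t e)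
        where
        e≢out : e ≢ out t
        e≢out e≡out = tail-e≢chip (trans (cong tail e≡out) (tail-out t))

  -- The number of chips sent along e when every vertex u fires F u times from rotor ρ u.
  flow : (Vertex → Edge) → (Vertex → ℕ) → Edge → ℕ
  flow ρ F e = visits (ρ (tail e)) (F (tail e)) e

  record ReturnVector (ρ : Vertex → Edge) (F : Vertex → ℕ) : Set where
    field
      full-turns : ∀ u → iter next (F u) (ρ u) ≡ ρ u
      balanced   : ∀ v → F v ≡ ∑[ e < m ] (𝟙 (v ≟ head e) * flow ρ F e)

  unicycle-reaches-chip : ∀ {w ρ} → Unicycle (w , ρ) → ∀ u → ∃ λ j → iter (succ ρ) j u ≡ w
  unicycle-reaches-chip {w} {ρ} (_ , (p , 1≤p , wᵖ≡w) , unique) u with reaches-cycle (succ ρ) u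
  ... | i , uⁱ-on-cycle with unique (iter (succ ρ) i u) uⁱ-on-cycle
  ...   | k , wᵏ≡uⁱ = k * p ∸ k + i , (begin
    iter (succ ρ) (k * p ∸ k + i) u                  ≡⟨ iter-+ (succ ρ) (k * p ∸ k) i u ⟩
    iter (succ ρ) (k * p ∸ k) (iter (succ ρ) i u)    ≡⟨ cong (iter (succ ρ) (k * p ∸ k)) wᵏ≡uⁱ ⟨
    iter (succ ρ) (k * p ∸ k) (iter (succ ρ) k w)    ≡⟨ periodic-return (succ ρ) 1≤p wᵖ≡w k ⟩
    w                                                ∎)
    where open ≡-Reasoning

  ≈-sym : ∀ {s s′} → s ≈ s′ → s′ ≈ s
  ≈-sym (w≡w′ , ρ≗ρ′) = sym w≡w′ , sym ∘ ρ≗ρ′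

  ≈-trans : ∀ {s s′ s″} → s ≈ s′ → s′ ≈ s″ → s ≈ s″
  ≈-trans (w≡w′ , ρ≗ρ′) (w′≡w″ , ρ′≗ρ″) = trans w≡w′ w′≡w″ , λ v → trans (ρ≗ρ′ v) (ρ′≗ρ″ v)

  step-cong : ∀ {s s′} → s ≈ s′ → step s ≈ step s′
  step-cong {w , ρ} {.w , ρ′} (refl , ρ≗ρ′) = cong (head ∘ next) (ρ≗ρ′ w) , update-cong
    where
    update-cong : ∀ v → update ρ w v ≡ update ρ′ w v
    update-cong v with v ≟ w
    ... | yes _ = cong next (ρ≗ρ′ w)
    ... | no  _ = ρ≗ρ′ v

  iter-step-cong : ∀ k {s s′} → s ≈ s′ → iter step k s ≈ iter step k s′
  iter-step-cong zero    s≈s′ = s≈s′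
  iter-step-cong (suc k) s≈s′ = step-cong (iter-step-cong k s≈s′)

  rotor-≈ : ∀ {s s′} → s ≈ s′ → RotorConfig (proj₂ s) → RotorConfig (proj₂ s′)
  rotor-≈ (_ , ρ≗ρ′) rc v = trans (cong tail (sym (ρ≗ρ′ v))) (rc v)

  stateCount : ℕ
  stateCount = n * m ^ n

  code : State → Fin stateCount
  code (w , ρ) = combine w (funToFin ρ)

  decode : Fin stateCount → State
  decode c = proj₁ (remQuot {n} (m ^ n) c) , finToFun (proj₂ (remQuot {n} (m ^ n) c))

  decode-code : ∀ s → decode (code s) ≈ s
  decode-code (w , ρ) = cong proj₁ split , λ v →
      trans (cong (λ wf → finToFun (proj₂ wf) v) split) (Fin.finToFun-funToFin ρ v)
    where
    split : remQuot {n} (m ^ n) (combine w (funToFin ρ)) ≡ (w , funToFin ρ)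
    split = Fin.remQuot-combine w (funToFin ρ)

  -- Ranging over codes rather than states makes ReturnTime decidable.
  ReturnTime : ℕ → Set
  ReturnTime L = 1 ≤ L × ∃ λ c → RotorConfig (proj₂ (decode c)) × iter step L (decode c) ≈ decode c

  returnTime? : Decidable ReturnTime
  returnTime? L = (1 ℕ.≤? L) ×-dec Fin.any? (λ c → rotor? (decode c) ×-dec ≈? (iter step L (decode c)) (decode c))
    where
    rotor? : ∀ s → Dec (RotorConfig (proj₂ s))
    rotor? (_ , ρ) = Fin.all? (λ v → tail (ρ v) ≟ v)
    ≈? : ∀ s s′ → Dec (s ≈ s′)
    ≈? (w , ρ) (w′ , ρ′) = (w ≟ w′) ×-dec Fin.all? (λ v → ρ v ≟ ρ′ v)

  returning⇒ReturnTime : ∀ L {z} → RotorConfig (proj₂ z) → 1 ≤ L → iter step L z ≈ z → ReturnTime L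
  returning⇒ReturnTime L {z} rc 1≤L z-returns = 1≤L , code z , rotor-≈ (≈-sym (decode-code z)) rc ,
    ≈-trans (iter-step-cong L (decode-code z)) (≈-trans z-returns (≈-sym (decode-code z)))

  module _ (co : CyclicOrdering) where

    returning⇒ReturnVector : ∀ {z L} → RotorConfig (proj₂ z) → iter step L z ≈ z →
                             ReturnVector (proj₂ z) (Walk.fired z L)
    returning⇒ReturnVector {z} {L} rc (chip-back , rotor-back) = record
      { full-turns = λ u → trans (sym (rotor-fired L u)) (rotor-back u)
      ; balanced   = λ v → begin
          fired L v                                     ≡⟨ fired≡arrived v ⟩
          arrived L v                                   ≡⟨ arrived-crossed L v ⟩
          ∑[ e < m ] (𝟙 (v ≟ head e) * crossed L e)
            ≡⟨ sum-cong-≗ (λ e → cong (𝟙 (v ≟ head e) *_) (crossed-visits (proj₁ co) rc L e)) ⟩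
          ∑[ e < m ] (𝟙 (v ≟ head e) * flow (proj₂ z) (fired L) e) ∎
      }
      where
      open Walk z
      open ≡-Reasoning
      fired≡arrived : ∀ v → fired L v ≡ arrived L v
      fired≡arrived v = +-cancelʳ-≡ _ _ _ (begin
        fired L v + 𝟙 (v ≟ chip 0)   ≡⟨ cong (λ w → fired L v + 𝟙 (v ≟ w)) chip-back ⟨
        fired L v + 𝟙 (v ≟ chip L)   ≡⟨ arrived-fired L v ⟨
        arrived L v + 𝟙 (v ≟ chip 0) ∎)

    -- ρ and ρ′ differ by rotations, and rotating a rotor does not change the edges it serves
    -- during full turns.
    ReturnVector-rotate : ∀ {ρ ρ′ F} → RotorConfig ρ → RotorConfig ρ′ →
                          ReturnVector ρ F → ReturnVector ρ′ F
    ReturnVector-rotate {ρ} {ρ′} {F} rc rc′ rv = record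
      { full-turns = λ u → let k , ρ′u≡ = turns-apart u in
          subst (λ a → iter next (F u) a ≡ a) ρ′u≡
            (trans (iter-comm next (F u) k (ρ u)) (cong (iter next k) (full-turns u)))
      ; balanced   = λ v → trans (balanced v) (sum-cong-≗ (λ e → cong (𝟙 (v ≟ head e) *_) (flow-≡ e)))
      }
      where
      open ReturnVector rv
      turns-apart : ∀ u → ∃ λ k → iter next k (ρ u) ≡ ρ′ u
      turns-apart u = proj₂ co (ρ u) (ρ′ u) (trans (rc u) (sym (rc′ u)))
      flow-≡ : ∀ e → flow ρ F e ≡ flow ρ′ F e
      flow-≡ e = let k , ρ′u≡ = turns-apart (tail e) in
        trans (sym (visits-rotate {K = F (tail e)} (full-turns (tail e)) k e))
              (cong (λ a → visits a (F (tail e)) e) ρ′u≡)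

    module _ {w ρ F} (ux : Unicycle (w , ρ)) (rv : ReturnVector ρ F) where
      open Walk (w , ρ)
      open ReturnVector rv

      Within : ℕ → Set
      Within t = ∀ u → fired t u ≤ F u

      Exhausted : ℕ → Vertex → Set
      Exhausted t u = fired t u ≡ F u

      within-suc : ∀ t → Within t → fired t (chip t) < F (chip t) → Within (suc t)
      within-suc t within fired<F u with u ≟ chip t
      ... | yes u≡chip = subst (λ y → suc (fired t y) ≤ F y) (sym u≡chip) fired<F
      ... | no  _      = within u

      -- Fuel ∑ F suffices: as long as no vertex is exhausted, τ = ∑ fired τ < ∑ F.
      first-exhaustion : ∃ λ τ → Within τ × Exhausted τ (chip τ)
      first-exhaustion = run (∑[ u < n ] F u) 0 refl (λ _ → z≤n)
        where
        run : ∀ k t → t + k ≡ ∑[ u < n ] F u → Within t → ∃ λ τ → Within τ × Exhausted τ (chip τ)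
        run zero    t t≡∑F within =
          t , within , ∑-mono-≡⇒≡ within (trans (∑-fired t) (trans (sym (+-identityʳ t)) t≡∑F)) (chip t)
        run (suc k) t t+1+k≡∑F within with fired t (chip t) ℕ.≟ F (chip t)
        ... | yes exhausted  = t , within , exhausted
        ... | no ¬exhausted =
          run k (suc t) (trans (sym (+-suc t k)) t+1+k≡∑F) (within-suc t within (≤∧≢⇒< (within _) ¬exhausted))

      crossed≤flow : ∀ τ → Within τ → ∀ e → crossed τ e ≤ flow ρ F e
      crossed≤flow τ within e =
        subst (_≤ flow ρ F e) (sym (crossed-visits (proj₁ co) (proj₁ ux) τ e)) (visits-mono (within (tail e)))

      arrived≤F : ∀ τ → Within τ → ∀ v → arrived τ v ≤ F v
      arrived≤F τ within v = subst₂ _≤_ (sym (arrived-crossed τ v)) (sym (balanced v))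
        (∑-mono (λ e → *-monoʳ-≤ (𝟙 (v ≟ head e)) (crossed≤flow τ within e)))

      exhausted-chip≡w : ∀ τ → Within τ → Exhausted τ (chip τ) → chip τ ≡ w
      exhausted-chip≡w τ within exhausted with chip τ ≟ w
      ... | yes chip≡w = chip≡w
      ... | no  chip≢w = ⊥-elim (<-irrefl refl (subst (_≤ F v) arrived≡1+F (arrived≤F τ within v)))
        where
        open ≡-Reasoning
        v = chip τ
        arrived≡1+F : arrived τ v ≡ suc (F v)
        arrived≡1+F = begin
          arrived τ v               ≡⟨ +-identityʳ _ ⟨
          arrived τ v + 0           ≡⟨ cong (arrived τ v +_) (𝟙-no (v ≟ w) chip≢w) ⟨
          arrived τ v + 𝟙 (v ≟ w)   ≡⟨ arrived-fired τ v ⟩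
          fired τ v + 𝟙 (v ≟ v)     ≡⟨ cong₂ _+_ exhausted (𝟙-yes (v ≟ v) refl) ⟩
          F v + 1                   ≡⟨ +-comm (F v) 1 ⟩
          suc (F v)                 ∎

      module _ (τ : ℕ) (within : Within τ) (chip≡w : chip τ ≡ w) where

        arrived≡fired : ∀ v → arrived τ v ≡ fired τ v
        arrived≡fired v = +-cancelʳ-≡ _ _ _
          (trans (arrived-fired τ v) (cong (λ c → fired τ v + 𝟙 (v ≟ c)) chip≡w))

        exhausted-backward : ∀ u → Exhausted τ (head (ρ u)) → Exhausted τ u
        exhausted-backward u exhausted with m≤n⇒m<n∨m≡n (within u)
        ... | inj₂ fired≡F = fired≡F
        ... | inj₁ fired<F = ⊥-elim (<-irrefl last-edge-saturated (visits-strict (full-turns u) fired<F))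
          where
          open ≡-Reasoning
          v = head (ρ u)
          in-edges-saturated : ∀ e → 𝟙 (v ≟ head e) * crossed τ e ≡ 𝟙 (v ≟ head e) * flow ρ F e
          in-edges-saturated = ∑-mono-≡⇒≡ (λ e → *-monoʳ-≤ (𝟙 (v ≟ head e)) (crossed≤flow τ within e)) (begin
            ∑[ e < m ] (𝟙 (v ≟ head e) * crossed τ e)   ≡⟨ arrived-crossed τ v ⟨
            arrived τ v                                 ≡⟨ arrived≡fired v ⟩
            fired τ v                                   ≡⟨ exhausted ⟩
            F v                                         ≡⟨ balanced v ⟩
            ∑[ e < m ] (𝟙 (v ≟ head e) * flow ρ F e)    ∎)
          last-edge-saturated : visits (ρ u) (fired τ u) (ρ u) ≡ visits (ρ u) (F u) (ρ u)
          last-edge-saturated = begin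
            visits (ρ u) (fired τ u) (ρ u)   ≡⟨ cong (λ y → visits (ρ y) (fired τ y) (ρ u)) (proj₁ ux u) ⟨
            visits (ρ (tail (ρ u))) (fired τ (tail (ρ u))) (ρ u)
                                             ≡⟨ crossed-visits (proj₁ co) (proj₁ ux) τ (ρ u) ⟨
            crossed τ (ρ u)                  ≡⟨ *-cancelˡ-≡ _ _ 1 (subst (λ k → k * crossed τ (ρ u) ≡ k * flow ρ F (ρ u))
                                                                        (𝟙-yes (v ≟ head (ρ u)) refl)
                                                                        (in-edges-saturated (ρ u))) ⟩
            flow ρ F (ρ u)                   ≡⟨ cong (λ y → visits (ρ y) (F y) (ρ u)) (proj₁ ux u) ⟩
            visits (ρ u) (F u) (ρ u)         ∎

        all-exhausted : Exhausted τ w → ∀ u → Exhausted τ u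
        all-exhausted exhausted-w u with unicycle-reaches-chip ux u
        ... | j , uʲ≡w = iter-reflect (succ ρ) (Exhausted τ) exhausted-backward j u
                           (subst (Exhausted τ) (sym uʲ≡w) exhausted-w)

      unicycle-returns : iter step (∑[ u < n ] F u) (w , ρ) ≈ (w , ρ)
      unicycle-returns with first-exhaustion
      ... | τ , within , exhausted = subst (λ t → iter step t (w , ρ) ≈ (w , ρ)) τ≡∑F
            (chip≡w , λ u → trans (rotor-fired τ u) (trans (cong (λ k → iter next k (ρ u)) (done u)) (full-turns u)))
        where
        chip≡w = exhausted-chip≡w τ within exhausted
        done : ∀ u → Exhausted τ u
        done = all-exhausted τ within chip≡w (subst (Exhausted τ) chip≡w exhausted)
        τ≡∑F : τ ≡ ∑[ u < n ] F u
        τ≡∑F = trans (sym (∑-fired τ)) (sum-cong-≗ done)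

    rotor-return⇒unicycle-return : ∀ L {x z} → Unicycle x → RotorConfig (proj₂ z) → iter step L z ≈ z → iter step L x ≈ x
    rotor-return⇒unicycle-return L {x} {z} ux rcz z-returns =
      subst (λ t → iter step t x ≈ x) (Walk.∑-fired z L)
        (unicycle-returns ux (ReturnVector-rotate rcz (proj₁ ux) (returning⇒ReturnVector {L = L} rcz z-returns)))

    rotor-step : ∀ {s} → RotorConfig (proj₂ s) → RotorConfig (proj₂ (step s))
    rotor-step {w , ρ} rc v with v ≟ w
    ... | yes v≡w = trans (proj₁ co (ρ w)) (trans (rc w) (sym v≡w))
    ... | no  _   = rc v

    rotor-iter : ∀ k {s} → RotorConfig (proj₂ s) → RotorConfig (proj₂ (iter step k s))
    rotor-iter zero    rc = rc
    rotor-iter (suc k) rc = rotor-step (rotor-iter k rc)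

    rotor-state-cycles : ∀ {x} → RotorConfig (proj₂ x) → ∃ λ d → d ≤ stateCount × ReturnTime d
    rotor-state-cycles {x} rc with Fin.pigeonhole (n<1+n stateCount) (λ i → code (iter step (toℕ i) x))
    ... | i , j , i<j , same-code = d , ≤-trans (m∸n≤m (toℕ j) (toℕ i)) (≤-pred (Fin.toℕ<n j)) ,
          returning⇒ReturnTime d (rotor-iter (toℕ i) rc) (m<n⇒0<n∸m i<j) (subst (_≈ xᵢ) (sym xⱼ≡) xⱼ≈xᵢ)
      where
      d = toℕ j ∸ toℕ i
      xᵢ = iter step (toℕ i) x
      xⱼ≡ : iter step d xᵢ ≡ iter step (toℕ j) x
      xⱼ≡ = trans (sym (iter-+ step d (toℕ i) x)) (cong (λ t → iter step t x) (m∸n+n≡m (<⇒≤ i<j)))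
      xⱼ≈xᵢ : iter step (toℕ j) x ≈ xᵢ
      xⱼ≈xᵢ = ≈-trans (≈-sym (decode-code _)) (subst (λ c → decode c ≈ xᵢ) same-code (decode-code xᵢ))

corollary1 : (D : RotorGraph) →
    RotorGraph.StronglyConnected D →
    RotorGraph.CyclicOrdering D →
    ∃ λ (N : ℕ) → ∀ x → RotorGraph.Unicycle D x → RotorGraph.IsOrbitSize D x N
corollary1 D _ co = case least-below returnTime? (suc stateCount) of λ where
    (inj₁ (N , _ , (1≤N , _ , rc , returns) , below)) → N , λ x ux →
      1≤N , rotor-return⇒unicycle-return co N ux rc returns ,
      λ k 1≤k k<N x-returns → below k k<N (returning⇒ReturnTime k (proj₁ ux) 1≤k x-returns)
    (inj₂ none) → 0 , λ x ux → let d , d≤K , returns = rotor-state-cycles co {x} (proj₁ ux) in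
      ⊥-elim (none d (s≤s d≤K) returns)
  where open Rotors D
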